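{- Let $F(x)=\frac{x}{1+x}$. For every reduced fraction $x\in[0,1]$ and every $k\ge5$, the number of nodes of degree $k$ in the Haros graph $G_x$ equals the number of nodes of degree $k+1$ in $G_{F(x)}$: $m_{k,x}=m_{k+1,F(x)}$.
   Context: Farey binary tree: $\ell_1=\{0/1,1/1\}$, $\ell_{n+1}$ = mediants $\frac{p+p'}{q+q'}$ of pairs $p/q<p'/q'$ adjacent in $\bigcup_{i\le n}\ell_i$; each reduced $p/q\in(0,1)$ is the mediant of a unique adjacent pair $p_1/q_1<p_2/q_2$ (its parents). Haros graphs: $G_0$ has two nodes joined by an edge. For ordered-node graphs $G$ ($v_1,\dots,v_a$) and $G'$ ($w_1,\dots,w_b$), $G\oplus G'$ has nodes $u_1,\dots,u_{a+b-1}$ obtained by identifying $v_a$ with $w_1$, keeping all edges, and adding an edge $u_1u_{a+b-1}$. $G_{0/1}=G_{1/1}=G_0$, $G_{p/q}=G_{p_1/q_1}\oplus G_{p_2/q_2}$ ($q+1$ nodes). Degree convention: the first and last nodes of $G_{p/q}$ are identified into one boundary node whose degree is the sum of their degrees; the remaining nodes keep their degrees. This gives $q$ nodes, and $m_{k,p/q}$ denotes the number of these $q$ nodes having degree $k$. -}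

module Defs where

open import Data.Nat using (ℕ; zero; suc; _+_; _*_; _∸_; _≟_; _<ᵇ_)
open import Data.Bool using (Bool; true; false; if_then_else_)
open import Data.List using (List; []; _∷_; map; _++_; length; filter; upTo)
open import Data.Product using (_×_; _,_; proj₁; proj₂)
open import Relation.Nullary.Decidable using (does)

-- An ordered-node (multi)graph: number of nodes a, nodes are 0 … a-1
-- (node i stands for v_{i+1}), and a list of edges (pairs of node indices).
record OGraph : Set where
  constructor ograph
  field
    size  : ℕ
    edges : List (ℕ × ℕ)
open OGraph public

G₀ : OGraph
G₀ = ograph 2 ((0 , 1) ∷ [])

shift : ℕ → ℕ × ℕ → ℕ × ℕ
shift s (i , j) = (s + i , s + j)

-- G ⊕ G' : identify the last node of G with the first node of G'
-- (G' nodes shifted by a-1), keep all edges, add the edge u₁ u_{a+b-1}.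
_⊕_ : OGraph → OGraph → OGraph
ograph a E ⊕ ograph b E' =
  ograph (a + b ∸ 1)
         ((0 , a + b ∸ 2) ∷ (E ++ map (shift (a ∸ 1)) E'))

-- Haros graph via descent in the Farey (Stern–Brocot) tree.
-- descend fuel a b c d GL GR p q : current adjacent interval a/b < c/d
-- with Haros graphs GL = G_{a/b}, GR = G_{c/d}; target p/q in (a/b,c/d).
-- The mediant (a+c)/(b+d) has parents a/b, c/d, so G = GL ⊕ GR.
descend : ℕ → ℕ → ℕ → ℕ → ℕ → OGraph → OGraph → ℕ → ℕ → OGraph
descend zero a b c d GL GR p q = GL ⊕ GR
descend (suc fuel) a b c d GL GR p q =
  let m = a + c ; n = b + d ; GM = GL ⊕ GR in
  if does (p * n ≟ q * m) then GM
  else if p * n <ᵇ q * m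
       then descend fuel a b m n GL GM p q
       else descend fuel m n c d GM GR p q

-- G_{p/q} for a reduced fraction p/q ∈ [0,1].  Fuel q suffices, since the
-- mediant denominators strictly increase along the descent.
Haros : ℕ → ℕ → OGraph
Haros zero q = G₀
Haros (suc p) q =
  if does (suc p ≟ q) then G₀ else descend q 0 1 1 1 G₀ G₀ (suc p) q

endpoints : List (ℕ × ℕ) → List ℕ
endpoints [] = []
endpoints ((i , j) ∷ E) = i ∷ j ∷ endpoints E

rawDeg : OGraph → ℕ → ℕ
rawDeg G i = length (filter (λ v → v ≟ i) (endpoints (edges G)))

-- Degree sequence under the paper's convention: first and last node
-- identified into one boundary node (degree = sum), others unchanged.
-- Gives size-1 (= q) degrees.
degrees : OGraph → List ℕ
degrees G = (rawDeg G 0 + rawDeg G (size G ∸ 1))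
          ∷ map (λ i → rawDeg G (suc i)) (upTo (size G ∸ 2))

m : ℕ → ℕ → ℕ → ℕ
m k p q = length (filter (λ d → d ≟ k) (degrees (Haros p q)))

-- F(x) = x/(1+x) sends a/b to a/(a+b) and commutes with taking mediants, so it maps the Farey
-- tree on [0,1] onto the one on [0,1/2]: the descent towards p/q from (0/1, 1/1) and the descent
-- towards p/(p+q) from (0/1, 1/2) take the same turns, and G_x, G_{F(x)} are built by the same
-- sequence of ⊕ from (G₀, G₀) and (G₀, G₀ ⊕ G₀).  Describe a graph by the degree of its first
-- node, the degrees of its inner nodes and the degree of its last node.  Along the joint descent
-- the first degrees of G_x and G_{F(x)} agree and the last degree of G_{F(x)} is one larger, so
-- their boundary nodes differ by one; an inner node of G_{F(x)} has degree one larger than its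
-- counterpart, except at junctions next to 0/1 or 1/1, where both degrees are below 5 and 6.
module Submission where

open import Defs
open import Data.Nat using (ℕ; zero; suc; _+_; _*_; _∸_; _≤_; _<_; _≟_; _<?_; _≡ᵇ_; _<ᵇ_; s≤s; z<s)
open import Data.Nat.Properties
open import Algebra.Properties.CommutativeSemigroup +-commutativeSemigroup using () renaming (interchange to +-interchange)
open import Data.Nat.Tactic.RingSolver using (solve)
open import Data.Nat.Coprimality using (Coprime)
open import Data.Bool using (true; false; if_then_else_)
open import Data.List using (List; []; _∷_; _++_; map; length; filter; upTo; applyUpTo)
open import Data.List.Properties using (filter-++; filter-none; length-++; ++-assoc; map-cong; map-upTo; map-id; map-∘)
open import Data.List.Relation.Unary.All as All using (All)
open import Data.Product using (_×_; _,_)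
open import Data.Sum using (_⊎_; inj₁; inj₂)
open import Data.Empty using (⊥-elim)
open import Function using (_∘_)
open import Relation.Binary using (tri<; tri≈; tri>)
open import Relation.Binary.PropositionalEquality
open import Relation.Nullary.Decidable using (dec-true; dec-false; from-yes; T?)

count : ℕ → List ℕ → ℕ
count k xs = length (filter (_≟ k) xs)

δ : ℕ → ℕ → ℕ
δ x i = if x ≡ᵇ i then 1 else 0

count-∷ : ∀ k x xs → count k (x ∷ xs) ≡ δ x k + count k xs
count-∷ k x xs with x ≡ᵇ k
... | true = refl
... | false = refl

count-++ : ∀ k xs ys → count k (xs ++ ys) ≡ count k xs + count k ys
count-++ k xs ys = trans (cong length (filter-++ (_≟ k) xs ys)) (length-++ (filter (_≟ k) xs))

count-below : ∀ {k xs} → All (_< k) xs → count k xs ≡ 0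
count-below xs<k = cong length (filter-none (_≟ _) (All.map <⇒≢ xs<k))

shiftR : ℕ → (ℕ → ℕ) → ℕ → ℕ
shiftR zero    g i       = g i
shiftR (suc s) g zero    = 0
shiftR (suc s) g (suc i) = shiftR s g i

shiftR-cong : ∀ s {g h : ℕ → ℕ} → (∀ i → g i ≡ h i) → ∀ i → shiftR s g i ≡ shiftR s h i
shiftR-cong zero    g≗h i       = g≗h i
shiftR-cong (suc s) g≗h zero    = refl
shiftR-cong (suc s) g≗h (suc i) = shiftR-cong s g≗h i

count-zero-map-suc : ∀ xs → count 0 (map suc xs) ≡ 0
count-zero-map-suc []       = refl
count-zero-map-suc (x ∷ xs) = count-zero-map-suc xs

count-suc-map-suc : ∀ k xs → count (suc k) (map suc xs) ≡ count k xs
count-suc-map-suc k []       = refl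
count-suc-map-suc k (x ∷ xs) = trans (count-∷ (suc k) (suc x) (map suc xs))
  (trans (cong (δ x k +_) (count-suc-map-suc k xs)) (sym (count-∷ k x xs)))

count-map-+ : ∀ s xs i → count i (map (s +_) xs) ≡ shiftR s (λ j → count j xs) i
count-map-+ zero    xs i       = cong (count i) (map-id xs)
count-map-+ (suc s) xs zero    = trans (cong (count 0) (map-∘ xs)) (count-zero-map-suc (map (s +_) xs))
count-map-+ (suc s) xs (suc i) =
  trans (cong (count (suc i)) (map-∘ xs))
        (trans (count-suc-map-suc i (map (s +_) xs)) (count-map-+ s xs i))

endpoints-++ : ∀ E E' → endpoints (E ++ E') ≡ endpoints E ++ endpoints E'
endpoints-++ []            E' = refl
endpoints-++ ((x , y) ∷ E) E' = cong (λ zs → x ∷ y ∷ zs) (endpoints-++ E E')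

endpoints-shift : ∀ s E → endpoints (map (shift s) E) ≡ map (s +_) (endpoints E)
endpoints-shift s []            = refl
endpoints-shift s ((x , y) ∷ E) = cong (λ zs → s + x ∷ s + y ∷ zs) (endpoints-shift s E)

count-endpoints-++-shift : ∀ s E E' i →
  count i (endpoints (E ++ map (shift s) E')) ≡ count i (endpoints E) + shiftR s (λ j → count j (endpoints E')) i
count-endpoints-++-shift s E E' i = begin
  count i (endpoints (E ++ map (shift s) E'))
    ≡⟨ cong (count i) (trans (endpoints-++ E _) (cong (endpoints E ++_) (endpoints-shift s E'))) ⟩
  count i (endpoints E ++ map (s +_) (endpoints E'))
    ≡⟨ count-++ i (endpoints E) _ ⟩
  count i (endpoints E) + count i (map (s +_) (endpoints E'))
    ≡⟨ cong (count i (endpoints E) +_) (count-map-+ s (endpoints E') i) ⟩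
  count i (endpoints E) + shiftR s (λ j → count j (endpoints E')) i ∎
  where open ≡-Reasoning

rawDeg-⊕ : ∀ G H i → rawDeg (G ⊕ H) i
         ≡ δ 0 i + (δ (size G + size H ∸ 2) i + (rawDeg G i + shiftR (size G ∸ 1) (rawDeg H) i))
rawDeg-⊕ (ograph a E) (ograph b E') i =
  trans (count-∷ i 0 _) (cong (δ 0 i +_) (trans (count-∷ i (a + b ∸ 2) _)
        (cong (δ (a + b ∸ 2) i +_) (count-endpoints-++-shift (a ∸ 1) E E' i))))

entry : List ℕ → ℕ → ℕ
entry []       i       = 0
entry (x ∷ xs) zero    = x
entry (x ∷ xs) (suc i) = entry xs i

entry-∷ʳ-suc : ∀ xs l j → entry (xs ++ suc l ∷ []) j ≡ δ (length xs) j + entry (xs ++ l ∷ []) j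
entry-∷ʳ-suc []       l zero    = refl
entry-∷ʳ-suc []       l (suc j) = refl
entry-∷ʳ-suc (x ∷ xs) l zero    = refl
entry-∷ʳ-suc (x ∷ xs) l (suc j) = entry-∷ʳ-suc xs l j

entry-join : ∀ I l f' I' l' j →
  entry (I ++ (l + f') ∷ I' ++ suc l' ∷ []) j
  ≡ δ (length I + suc (length I')) j + (entry (I ++ l ∷ []) j + shiftR (length I) (entry (f' ∷ I' ++ l' ∷ [])) j)
entry-join []      l f' I' l' zero    = refl
entry-join []      l f' I' l' (suc j) =
  trans (entry-∷ʳ-suc I' l' j) (cong (δ (length I') j +_) (sym (+-identityˡ _)))
entry-join (x ∷ I) l f' I' l' zero    = sym (+-identityʳ x)
entry-join (x ∷ I) l f' I' l' (suc j) = entry-join I l f' I' l' j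

applyUpTo-entry : ∀ I t → applyUpTo (entry (I ++ t)) (length I) ≡ I
applyUpTo-entry []      t = refl
applyUpTo-entry (x ∷ I) t = cong (x ∷_) (applyUpTo-entry I t)

entry-length : ∀ I l → entry (I ++ l ∷ []) (length I) ≡ l
entry-length []      l = refl
entry-length (x ∷ I) l = entry-length I l

record Profile : Set where
  constructor ⟨_,_,_⟩
  field
    start : ℕ
    inner : List ℕ
    end   : ℕ
open Profile

degreeAt : Profile → ℕ → ℕ
degreeAt ⟨ f , I , l ⟩ = entry (f ∷ I ++ l ∷ [])

_⊕ᵖ_ : Profile → Profile → Profile
⟨ f , I , l ⟩ ⊕ᵖ ⟨ f' , I' , l' ⟩ = ⟨ suc f , I ++ (l + f') ∷ I' , suc l' ⟩

degreeAt-⊕ᵖ : ∀ P Q i → degreeAt (P ⊕ᵖ Q) i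
  ≡ δ 0 i + (δ (suc (length (inner P) + suc (length (inner Q)))) i
          + (degreeAt P i + shiftR (suc (length (inner P))) (degreeAt Q) i))
degreeAt-⊕ᵖ ⟨ f , I , l ⟩ ⟨ f' , I' , l' ⟩ zero    = cong suc (sym (+-identityʳ f))
degreeAt-⊕ᵖ ⟨ f , I , l ⟩ ⟨ f' , I' , l' ⟩ (suc j) =
  trans (cong (λ xs → entry xs j) (++-assoc I ((l + f') ∷ I') (suc l' ∷ [])))
        (entry-join I l f' I' l' j)

record _HasProfile_ (G : OGraph) (P : Profile) : Set where
  constructor has-profile
  field
    size-profile   : size G ≡ 2 + length (inner P)
    rawDeg-profile : ∀ i → rawDeg G i ≡ degreeAt P i

G₀-profile : G₀ HasProfile ⟨ 1 , [] , 1 ⟩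
G₀-profile = has-profile refl rawDeg-G₀
  where
  rawDeg-G₀ : ∀ i → rawDeg G₀ i ≡ degreeAt ⟨ 1 , [] , 1 ⟩ i
  rawDeg-G₀ zero          = refl
  rawDeg-G₀ (suc zero)    = refl
  rawDeg-G₀ (suc (suc i)) = refl

⊕-profile : ∀ {G H P Q} → G HasProfile P → H HasProfile Q → (G ⊕ H) HasProfile (P ⊕ᵖ Q)
⊕-profile {ograph _ E} {ograph _ E'} {P} {Q} (has-profile refl degG) (has-profile refl degH) =
  has-profile size-⊕ degree-⊕
  where
  n = length (inner P)
  n' = length (inner Q)
  size-⊕ : suc (n + suc (suc n')) ≡ 2 + length (inner (P ⊕ᵖ Q))
  size-⊕ = cong suc (trans (+-suc n (suc n')) (cong suc (sym (length-++ (inner P)))))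
  degree-⊕ : ∀ i → rawDeg (ograph (2 + n) E ⊕ ograph (2 + n') E') i ≡ degreeAt (P ⊕ᵖ Q) i
  degree-⊕ i = begin
    rawDeg (ograph (2 + n) E ⊕ ograph (2 + n') E') i
      ≡⟨ rawDeg-⊕ (ograph (2 + n) E) (ograph (2 + n') E') i ⟩
    δ 0 i + (δ (n + suc (suc n')) i + (rawDeg (ograph (2 + n) E) i + shiftR (suc n) (rawDeg (ograph (2 + n') E')) i))
      ≡⟨ cong₂ (λ x y → δ 0 i + (δ x i + y)) (+-suc n (suc n')) (cong₂ _+_ (degG i) (shiftR-cong (suc n) degH i)) ⟩
    δ 0 i + (δ (suc (n + suc n')) i + (degreeAt P i + shiftR (suc n) (degreeAt Q) i))
      ≡⟨ sym (degreeAt-⊕ᵖ P Q i) ⟩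
    degreeAt (P ⊕ᵖ Q) i ∎
    where open ≡-Reasoning

degrees-profile : ∀ {G P} → G HasProfile P → degrees G ≡ (start P + end P) ∷ inner P
degrees-profile {ograph _ E} {⟨ f , I , l ⟩} (has-profile refl deg) =
  cong₂ _∷_ (cong₂ _+_ (deg 0) (trans (deg (suc (length I))) (entry-length I l)))
            (begin
              map (λ i → rawDeg (ograph (2 + length I) E) (suc i)) (upTo (length I))
                ≡⟨ map-cong (λ i → deg (suc i)) (upTo (length I)) ⟩
              map (entry (I ++ l ∷ [])) (upTo (length I))
                ≡⟨ map-upTo (entry (I ++ l ∷ [])) (length I) ⟩
              applyUpTo (entry (I ++ l ∷ [])) (length I)
                ≡⟨ applyUpTo-entry I (l ∷ []) ⟩
              I ∎)
  where open ≡-Reasoning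

module _ (fuel a b c d : ℕ) (GL GR : OGraph) (p q : ℕ) where

  descend-≡ : p * (b + d) ≡ q * (a + c) → descend (suc fuel) a b c d GL GR p q ≡ GL ⊕ GR
  descend-≡ eq rewrite dec-true (p * (b + d) ≟ q * (a + c)) eq = refl

  descend-< : p * (b + d) < q * (a + c) →
              descend (suc fuel) a b c d GL GR p q ≡ descend fuel a b (a + c) (b + d) GL (GL ⊕ GR) p q
  descend-< lt rewrite dec-false (p * (b + d) ≟ q * (a + c)) (<⇒≢ lt)
                     | dec-true (T? (p * (b + d) <ᵇ q * (a + c))) (<⇒<ᵇ lt) = refl

  descend-> : q * (a + c) < p * (b + d) →
              descend (suc fuel) a b c d GL GR p q ≡ descend fuel (a + c) (b + d) c d (GL ⊕ GR) GR p q
  descend-> gt rewrite dec-false (p * (b + d) ≟ q * (a + c)) (≢-sym (<⇒≢ gt))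
                     | dec-false (T? (p * (b + d) <ᵇ q * (a + c))) (<⇒≱ gt ∘ <⇒≤ ∘ <ᵇ⇒< _ _) = refl

farey-denominators : ∀ {a b c d p q} → b * c ≡ suc (a * d) → q * a < p * b → d * p < c * q → b + d ≤ q
farey-denominators {a} {b} {c} {d} {p} {q} neighbours above below =
  +-cancelˡ-≤ (d * (q * a)) (b + d) q (begin
    d * (q * a) + (b + d) ≡⟨ solve (a ∷ b ∷ d ∷ q ∷ []) ⟩
    d * (1 + q * a) + b   ≤⟨ +-monoˡ-≤ b (*-monoʳ-≤ d above) ⟩
    d * (p * b) + b       ≡⟨ solve (b ∷ d ∷ p ∷ []) ⟩
    b * (1 + d * p)       ≤⟨ *-monoʳ-≤ b below ⟩
    b * (c * q)           ≡⟨ solve (b ∷ c ∷ q ∷ []) ⟩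
    q * (b * c)           ≡⟨ cong (q *_) neighbours ⟩
    q * (1 + a * d)       ≡⟨ solve (a ∷ d ∷ q ∷ []) ⟩
    d * (q * a) + q       ∎)
  where open ≤-Reasoning

record FareyBracket (a b c d p q : ℕ) : Set where
  field
    neighbours : b * c ≡ suc (a * d)
    above      : q * a < p * b
    below      : d * p < c * q
    d>0        : 0 < d
open FareyBracket

module _ {a b c d p q : ℕ} (bracket : FareyBracket a b c d p q) where

  bracket-b>0 : 0 < b
  bracket-b>0 = n≢0⇒n>0 λ b≡0 →
    n≮0 (subst (q * a <_) (trans (cong (p *_) b≡0) (*-zeroʳ p)) (above bracket))

  bracket-denominators : b + d ≤ q
  bracket-denominators = farey-denominators (neighbours bracket) (above bracket) (below bracket)

  bracket-left : p * (b + d) < q * (a + c) → FareyBracket a b (a + c) (b + d) p q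
  bracket-left lt = record
    { neighbours = begin
        b * (a + c)         ≡⟨ solve (a ∷ b ∷ c ∷ []) ⟩
        a * b + b * c       ≡⟨ cong (a * b +_) (neighbours bracket) ⟩
        a * b + suc (a * d) ≡⟨ +-suc (a * b) (a * d) ⟩
        suc (a * b + a * d) ≡⟨ cong suc (*-distribˡ-+ a b d) ⟨
        suc (a * (b + d))   ∎
    ; above = above bracket
    ; below = subst₂ _<_ (*-comm p (b + d)) (*-comm q (a + c)) lt
    ; d>0   = ≤-trans bracket-b>0 (m≤m+n b d)
    }
    where open ≡-Reasoning

  bracket-right : q * (a + c) < p * (b + d) → FareyBracket (a + c) (b + d) c d p q
  bracket-right gt = record
    { neighbours = begin
        (b + d) * c         ≡⟨ solve (b ∷ c ∷ d ∷ []) ⟩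
        b * c + c * d       ≡⟨ cong (_+ c * d) (neighbours bracket) ⟩
        suc (a * d + c * d) ≡⟨ cong suc (*-distribʳ-+ d a c) ⟨
        suc ((a + c) * d)   ∎
    ; above = gt
    ; below = below bracket
    ; d>0   = d>0 bracket
    }
    where open ≡-Reasoning

1+m+n≤m+[o+n] : ∀ m {o} n → 0 < o → suc m + n ≤ m + (o + n)
1+m+n≤m+[o+n] m n o>0 = ≤-trans (≤-reflexive (sym (+-suc m n))) (+-monoʳ-≤ m (+-monoˡ-≤ n o>0))

-- The descent stops before b + d exceeds q.
descend-fuel-stable : ∀ {fuel fuel' a b c d p q GL GR} → FareyBracket a b c d p q →
                      q < fuel + (b + d) → fuel ≤ fuel' →
                      descend fuel a b c d GL GR p q ≡ descend fuel' a b c d GL GR p q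
descend-fuel-stable {zero} bracket q<budget _ = ⊥-elim (<⇒≱ q<budget (bracket-denominators bracket))
descend-fuel-stable {suc fuel} {suc fuel'} {a} {b} {c} {d} {p} {q} {GL} {GR} bracket q<budget (s≤s fuel≤fuel')
  with <-cmp (p * (b + d)) (q * (a + c))
... | tri≈ _ eq _ = trans (descend-≡ fuel a b c d GL GR p q eq) (sym (descend-≡ fuel' a b c d GL GR p q eq))
... | tri< lt _ _ = trans (descend-< fuel a b c d GL GR p q lt) (trans
      (descend-fuel-stable (bracket-left bracket lt)
         (<-≤-trans q<budget (1+m+n≤m+[o+n] fuel (b + d) (bracket-b>0 bracket))) fuel≤fuel')
      (sym (descend-< fuel' a b c d GL GR p q lt)))
... | tri> _ _ gt = trans (descend-> fuel a b c d GL GR p q gt) (trans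
      (descend-fuel-stable (bracket-right bracket gt)
         (<-≤-trans q<budget (≤-trans (1+m+n≤m+[o+n] fuel (b + d) (d>0 bracket))
                                    (≤-reflexive (cong (fuel +_) (+-comm d (b + d)))))) fuel≤fuel')
      (sym (descend-> fuel' a b c d GL GR p q gt)))

-- Comparing p/(p+q) with the mediant of a/(a+b) and c/(c+d) is comparing p/q with that of a/b and c/d.
module _ (a b c d p q : ℕ) where

  image-numerator : p * ((a + b) + (c + d)) ≡ p * (a + c) + p * (b + d)
  image-numerator = trans (cong (p *_) (+-interchange a b c d)) (*-distribˡ-+ p (a + c) (b + d))

  image-≡ : p * (b + d) ≡ q * (a + c) → p * ((a + b) + (c + d)) ≡ (p + q) * (a + c)
  image-≡ eq = trans image-numerator
    (trans (cong (p * (a + c) +_) eq) (sym (*-distribʳ-+ (a + c) p q)))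

  image-< : p * (b + d) < q * (a + c) → p * ((a + b) + (c + d)) < (p + q) * (a + c)
  image-< lt = subst₂ _<_ (sym image-numerator) (sym (*-distribʳ-+ (a + c) p q))
    (+-monoʳ-< (p * (a + c)) lt)

  image-> : q * (a + c) < p * (b + d) → (p + q) * (a + c) < p * ((a + b) + (c + d))
  image-> gt = subst₂ _<_ (sym (*-distribʳ-+ (a + c) p q)) (sym image-numerator)
    (+-monoʳ-< (p * (a + c)) gt)

record CountsShifted (xs ys : List ℕ) : Set where
  constructor counts-shifted
  field count-shifted : ∀ k → 5 ≤ k → count k xs ≡ count (suc k) ys
open CountsShifted

counts-shifted-++ : ∀ {xs xs' ys ys'} → CountsShifted xs xs' → CountsShifted ys ys' →
                    CountsShifted (xs ++ ys) (xs' ++ ys')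
counts-shifted-++ {xs} {xs'} xs↑ ys↑ = counts-shifted λ k k≥5 →
  trans (count-++ k xs _)
        (trans (cong₂ _+_ (count-shifted xs↑ k k≥5) (count-shifted ys↑ k k≥5)) (sym (count-++ (suc k) xs' _)))

counts-shifted-low : ∀ {xs ys} → All (_< 5) xs → All (_< 6) ys → CountsShifted xs ys
counts-shifted-low xs<5 ys<6 = counts-shifted λ k k≥5 →
  trans (count-below (All.map (λ x<5 → <-≤-trans x<5 k≥5) xs<5))
        (sym (count-below (All.map (λ y<6 → <-≤-trans y<6 (s≤s k≥5)) ys<6)))

Bumped : ℕ → ℕ → Set
Bumped x x' = x' ≡ suc x ⊎ (x < 5 × x' < 6)

bumped-counts-shifted : ∀ {x x'} → Bumped x x' → CountsShifted (x ∷ []) (x' ∷ [])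
bumped-counts-shifted {x} (inj₁ refl) = counts-shifted λ k _ → trans (count-∷ k x []) (sym (count-∷ (suc k) (suc x) []))
bumped-counts-shifted (inj₂ (x<5 , x'<6)) = counts-shifted-low (x<5 All.∷ All.[]) (x'<6 All.∷ All.[])

record Twin : Set where
  field
    graph graph'     : OGraph
    profile profile' : Profile
    graph-profile    : graph HasProfile profile
    graph'-profile   : graph' HasProfile profile'
    inner-shifted    : CountsShifted (inner profile) (inner profile')
open Twin

Junction : Twin → Twin → Set
Junction L R = Bumped (end (profile L) + start (profile R)) (end (profile' L) + start (profile' R))

join : (L R : Twin) → Junction L R → Twin
join L R junction = record
  { graph          = graph L ⊕ graph R
  ; graph'         = graph' L ⊕ graph' R
  ; profile        = profile L ⊕ᵖ profile R
  ; profile'       = profile' L ⊕ᵖ profile' R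
  ; graph-profile  = ⊕-profile (graph-profile L) (graph-profile R)
  ; graph'-profile = ⊕-profile (graph'-profile L) (graph'-profile R)
  ; inner-shifted  = counts-shifted-++ (inner-shifted L)
                       (counts-shifted-++ (bumped-counts-shifted junction) (inner-shifted R))
  }

Balanced : Twin → Set
Balanced T = start (profile' T) ≡ start (profile T) × end (profile' T) ≡ suc (end (profile T))

balanced-counts-shifted : ∀ {T} → Balanced T → CountsShifted (degrees (graph T)) (degrees (graph' T))
balanced-counts-shifted {T} (start≡ , end≡) =
  subst₂ CountsShifted (sym (degrees-profile (graph-profile T))) (sym (degrees-profile (graph'-profile T)))
    (counts-shifted-++ (bumped-counts-shifted (inj₁ (trans (cong₂ _+_ start≡ end≡) (+-suc _ _))))
                       (inner-shifted T))

-- The twins (G_{0/1}, G_{F(0/1)}) and (G_{1/1}, G_{F(1/1)}) = (G₀, G₀ ⊕ G₀).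
twin₀ twin₁ : Twin
twin₀ = record
  { graph = G₀ ; graph' = G₀ ; profile = ⟨ 1 , [] , 1 ⟩ ; profile' = ⟨ 1 , [] , 1 ⟩
  ; graph-profile = G₀-profile ; graph'-profile = G₀-profile ; inner-shifted = counts-shifted λ _ _ → refl }
twin₁ = record
  { graph = G₀ ; graph' = G₀ ⊕ G₀ ; profile = ⟨ 1 , [] , 1 ⟩ ; profile' = ⟨ 2 , 2 ∷ [] , 2 ⟩
  ; graph-profile = G₀-profile ; graph'-profile = ⊕-profile G₀-profile G₀-profile
  ; inner-shifted = counts-shifted-low All.[] (from-yes (All.all? (_<? 6) (2 ∷ []))) }

data LeftEnd : Twin → Set where
  left-zero     : LeftEnd twin₀
  left-mediant  : ∀ {T} → Balanced T → LeftEnd T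

data RightEnd : Twin → Set where
  right-one     : RightEnd twin₁
  right-mediant : ∀ {T} → Balanced T → RightEnd T

join-balanced : ∀ {L R} j → LeftEnd L → RightEnd R → Balanced (join L R j)
join-balanced j left-zero             right-one             = refl , refl
join-balanced j left-zero             (right-mediant (_ , e)) = refl , cong suc e
join-balanced j (left-mediant (s , _)) right-one             = cong suc s , refl
join-balanced j (left-mediant (s , _)) (right-mediant (_ , e)) = cong suc s , cong suc e

junction-left : ∀ {L R} j → LeftEnd L → Junction L (join L R j)
junction-left j left-zero = inj₂ (from-yes (3 <? 5) , from-yes (3 <? 6))
junction-left j (left-mediant (s , e)) rewrite s | e = inj₁ refl

junction-right : ∀ {L R} j → RightEnd R → Junction (join L R j) R
junction-right j right-one = inj₂ (from-yes (3 <? 5) , from-yes (5 <? 6))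
junction-right j (right-mediant (s , e)) rewrite s | e = inj₁ refl

record BalancedTwin (G G' : OGraph) : Set where
  field
    twin     : Twin
    balanced : Balanced twin
    graph≡   : graph twin ≡ G
    graph'≡  : graph' twin ≡ G'
open BalancedTwin

joined : ∀ L R j → LeftEnd L → RightEnd R → BalancedTwin (graph L ⊕ graph R) (graph' L ⊕ graph' R)
joined L R j left right = record
  { twin = join L R j ; balanced = join-balanced j left right ; graph≡ = refl ; graph'≡ = refl }

-- The denominators a + b and c + d of the images are given up to equality: in the recursive
-- calls they arise as (a + b) + (c + d) rather than (a + c) + (b + d).
twin-descend : ∀ fuel a b c d p q {b' d'} → b' ≡ a + b → d' ≡ c + d →
               ∀ L R → LeftEnd L → RightEnd R → Junction L R →
               BalancedTwin (descend fuel a b c d (graph L) (graph R) p q)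
                            (descend fuel a b' c d' (graph' L) (graph' R) p (p + q))
twin-descend zero a b c d p q refl refl L R left right j = joined L R j left right
twin-descend (suc fuel) a b c d p q refl refl L R left right j
  with <-cmp (p * (b + d)) (q * (a + c))
... | tri≈ _ eq _ = subst₂ BalancedTwin
        (sym (descend-≡ fuel a b c d (graph L) (graph R) p q eq))
        (sym (descend-≡ fuel a (a + b) c (c + d) (graph' L) (graph' R) p (p + q) (image-≡ a b c d p q eq)))
        (joined L R j left right)
... | tri< lt _ _ = subst₂ BalancedTwin
        (sym (descend-< fuel a b c d (graph L) (graph R) p q lt))
        (sym (descend-< fuel a (a + b) c (c + d) (graph' L) (graph' R) p (p + q) (image-< a b c d p q lt)))
        (twin-descend fuel a b (a + c) (b + d) p q refl (+-interchange a b c d)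
           L (join L R j) left (right-mediant (join-balanced j left right)) (junction-left {R = R} j left))
... | tri> _ _ gt = subst₂ BalancedTwin
        (sym (descend-> fuel a b c d (graph L) (graph R) p q gt))
        (sym (descend-> fuel a (a + b) c (c + d) (graph' L) (graph' R) p (p + q) (image-> a b c d p q gt)))
        (twin-descend fuel (a + c) (b + d) c d p q (+-interchange a b c d) refl
           (join L R j) R (left-mediant (join-balanced j left right)) right (junction-right {L = L} j right))

balanced-twin-counts-shifted : ∀ {G G'} → BalancedTwin G G' → CountsShifted (degrees G) (degrees G')
balanced-twin-counts-shifted t =
  subst₂ (λ H H' → CountsShifted (degrees H) (degrees H')) (graph≡ t) (graph'≡ t)
         (balanced-counts-shifted {twin t} (balanced t))

n+n≡n*2 : ∀ n → n + n ≡ n * 2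
n+n≡n*2 n = trans (cong (n +_) (sym (+-identityʳ n))) (*-comm 2 n)

Haros-interior : ∀ {p q} → 0 < p → p < q → Haros p q ≡ descend q 0 1 1 1 G₀ G₀ p q
Haros-interior {suc p} {q} _ p<q rewrite dec-false (suc p ≟ q) (<⇒≢ p<q) = refl

Haros-one : ∀ p → Haros (suc p) (suc p) ≡ G₀
Haros-one p rewrite dec-true (suc p ≟ suc p) refl = refl

Haros-half : ∀ p → Haros (suc p) (suc p + suc p) ≡ G₀ ⊕ G₀
Haros-half p = trans (Haros-interior z<s (m<m+n (suc p) z<s))
  (descend-≡ (p + suc p) 0 1 1 1 G₀ G₀ (suc p) (suc p + suc p)
    (trans (sym (n+n≡n*2 (suc p))) (sym (*-identityʳ _))))

Haros-twin : ∀ p q → suc p < q → BalancedTwin (Haros (suc p) q) (Haros (suc p) (suc p + q))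
Haros-twin p q P<q = subst₂ BalancedTwin (sym Haros-P/q) (sym Haros-P/P+q)
  (twin-descend (p + q) 0 1 1 1 P q refl refl twin₀ twin₁ left-zero right-one (inj₁ refl))
  where
  P = suc p
  bracket : FareyBracket 0 1 1 1 P q
  bracket = record
    { neighbours = refl
    ; above      = subst₂ _<_ (sym (*-zeroʳ q)) (sym (*-identityʳ P)) z<s
    ; below      = subst₂ _<_ (sym (*-identityˡ P)) (sym (*-identityˡ q)) P<q
    ; d>0        = z<s
    }
  Haros-P/q : Haros P q ≡ descend (p + q) 0 1 1 1 G₀ G₀ P q
  Haros-P/q = trans (Haros-interior z<s P<q)
    (descend-fuel-stable bracket (m<m+n q z<s) (m≤n+m q p))
  Haros-P/P+q : Haros P (P + q) ≡ descend (p + q) 0 1 1 2 G₀ (G₀ ⊕ G₀) P (P + q)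
  Haros-P/P+q = trans (Haros-interior z<s (m<m+n P (m<n⇒0<n P<q)))
    (descend-< (p + q) 0 1 1 1 G₀ G₀ P (P + q)
      (subst₂ _<_ (n+n≡n*2 P) (sym (*-identityʳ (P + q))) (+-monoʳ-< P P<q)))

Haros-counts-shifted : ∀ p q → p ≤ q → CountsShifted (degrees (Haros p q)) (degrees (Haros p (p + q)))
Haros-counts-shifted zero q _ = counts-shifted-low (from-yes (All.all? (_<? 5) (2 ∷ [])))
                                                    (from-yes (All.all? (_<? 6) (2 ∷ [])))
Haros-counts-shifted (suc p) q P≤q with m≤n⇒m<n∨m≡n P≤q
... | inj₁ P<q  = balanced-twin-counts-shifted (Haros-twin p q P<q)
... | inj₂ refl rewrite Haros-one p | Haros-half p =
  counts-shifted-low (from-yes (All.all? (_<? 5) (2 ∷ []))) (from-yes (All.all? (_<? 6) (4 ∷ 2 ∷ [])))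

lemma10 : (p q : ℕ) → Coprime p q → p ≤ q →
          (k : ℕ) → 5 ≤ k → m k p q ≡ m (suc k) p (p + q)
lemma10 p q _ p≤q = count-shifted (Haros-counts-shifted p q p≤q)
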